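{- Let $T$ be a preiteration theory. Then $T$ satisfies the functorial implication for injective base morphisms if and only if $T$ satisfies the permutation identity and the identity $$(\mathbf{1}_n \oplus 0_m) \cdot \langle f\cdot (\mathbf{1}_n \oplus 0_m \oplus \mathbf{1}_p),\, g\rangle^\dagger = f^\dagger$$ for all $n,m,p$ and all $f: n \to n + p$, $g: m \to n + m + p$ in $T$.
   Context: Algebraic theories are taken in the sense of Bloom and Ésik: a theory $T$ is a category whose objects are the natural numbers, with composition written in diagrammatic order ($f\cdot g: n\to q$ for $f:n\to p$, $g:p\to q$). For each $p$ there are distinguished morphisms $i_p(1),\dots,i_p(p): 1\to p$, and every morphism $f:n\to p$ is uniquely a tuple $\langle f_1,\dots,f_n\rangle$ of morphisms $f_j:1\to p$; more generally $\langle f,g\rangle : n+m\to p$ is the tupling of $f:n\to p$ and $g:m\to p$. $\mathbf{1}_n$ is the identity on $n$ and $0_p:0\to p$ is the unique morphism. A base morphism $\rho:n\to p$ is one of the form $\langle i_p(\rho(1)),\dots,i_p(\rho(n))\rangle$ for a function $\rho:\{1,\dots,n\}\to\{1,\dots,p\}$; it is injective/bijective if that function is. For $f:n\to p$, $g:m\to q$, $f\oplus g = \langle f\cdot\kappa, g\cdot\lambda\rangle : n+m\to p+q$ where $\kappa:p\to p+q$, $\lambda:q\to p+q$ are the base injections onto the first $p$ and last $q$ positions. A preiteration theory is a theory $T$ with an operation assigning to each $f:n\to n+p$ a morphism $f^\dagger:n\to p$. Permutation identity: $(\pi\cdot f\cdot(\pi^{ -1}\oplus\mathbf{1}_p))^\dagger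 = \pi\cdot f^\dagger$ for all $f:n\to n+p$ and base bijections $\pi:n\to n$. For a set $\mathcal{C}$ of morphisms of $T$, $T$ satisfies the functorial implication for $\mathcal{C}$ if for all $f:n\to n+p$, $g:m\to m+p$ in $T$ and $\rho:n\to m$ in $\mathcal{C}$: $f\cdot(\rho\oplus\mathbf{1}_p) = \rho\cdot g$ implies $f^\dagger = \rho\cdot g^\dagger$. -}

module Defs where

open import Level using (Level; suc; _⊔_)
open import Data.Nat using (ℕ; _+_)
open import Data.Fin using (Fin; splitAt; _↑ˡ_; _↑ʳ_)
open import Data.Sum using (inj₁; inj₂)
open import Data.Product using (_×_)
open import Function.Definitions using (Injective)
open import Function.Bundles using (_↔_; Inverse)
open import Relation.Binary.PropositionalEquality using (_≡_; subst)
open import Data.Nat.Properties using (+-identityʳ)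

-- An algebraic theory in the sense of Bloom–Ésik: a category whose objects
-- are the natural numbers, composition in diagrammatic order, such that each
-- p is the coproduct of p copies of 1 with injections i_p(1..p) : 1 → p.
record Theory (ℓ : Level) : Set (suc ℓ) where
  infixl 7 _·_
  field
    Hom   : ℕ → ℕ → Set ℓ
    _·_   : ∀ {n p q} → Hom n p → Hom p q → Hom n q
    𝟏     : ∀ n → Hom n n
    ·-assoc : ∀ {n p q r} (f : Hom n p) (g : Hom p q) (h : Hom q r) →
              (f · g) · h ≡ f · (g · h)
    ·-idˡ : ∀ {n p} (f : Hom n p) → 𝟏 n · f ≡ f
    ·-idʳ : ∀ {n p} (f : Hom n p) → f · 𝟏 p ≡ f
    i     : ∀ p → Fin p → Hom 1 p
    tuple : ∀ {n p} → (Fin n → Hom 1 p) → Hom n p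
    tuple-comp : ∀ {n p} (fs : Fin n → Hom 1 p) (j : Fin n) →
                 i n j · tuple fs ≡ fs j
    tuple-unique : ∀ {n p} (fs : Fin n → Hom 1 p) (h : Hom n p) →
                   (∀ j → i n j · h ≡ fs j) → h ≡ tuple fs

record PreiterationTheory (ℓ : Level) : Set (suc ℓ) where
  field
    theory : Theory ℓ
  open Theory theory public
  field
    _† : ∀ {n p} → Hom n (n + p) → Hom n p

module _ {ℓ} (T : Theory ℓ) where
  open Theory T

  base : ∀ {n p} → (Fin n → Fin p) → Hom n p
  base {n} {p} ρ = tuple (λ j → i p (ρ j))

  ⟨_,_⟩ : ∀ {n m p} → Hom n p → Hom m p → Hom (n + m) p
  ⟨_,_⟩ {n} {m} f g = tuple (λ j → h (splitAt n j))
    where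
    h : _ → _
    h (inj₁ a) = i n a · f
    h (inj₂ b) = i m b · g

  κ : ∀ p q → Hom p (p + q)
  κ p q = base (λ a → a ↑ˡ q)

  λ′ : ∀ p q → Hom q (p + q)
  λ′ p q = base (λ b → p ↑ʳ b)

  infixl 6 _⊕_
  _⊕_ : ∀ {n p m q} → Hom n p → Hom m q → Hom (n + m) (p + q)
  _⊕_ {p = p} {q = q} f g = ⟨ f · κ p q , g · λ′ p q ⟩

  0ₕ : ∀ p → Hom 0 p
  0ₕ p = tuple (λ ())

  -- 1_n ⊕ 0_m : n + 0 → n + m, viewed as a morphism n → n + m
  -- (transported along the equation n + 0 = n)
  𝟏⊕0 : ∀ n m → Hom n (n + m)
  𝟏⊕0 n m = subst (λ k → Hom k (n + m)) (+-identityʳ n) (𝟏 n ⊕ 0ₕ m)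

module _ {ℓ} (T : PreiterationTheory ℓ) where
  open PreiterationTheory T
  private Th = theory

  PermutationIdentity : Set ℓ
  PermutationIdentity =
    ∀ {n p} (f : Hom n (n + p)) (π : Fin n ↔ Fin n) →
    ((base Th (Inverse.to π) · f · _⊕_ Th (base Th (Inverse.from π)) (𝟏 p)) †)
      ≡ base Th (Inverse.to π) · (f †)

  FunctorialImplicationInj : Set ℓ
  FunctorialImplicationInj =
    ∀ {n m p} (f : Hom n (n + p)) (g : Hom m (m + p))
      (ρ : Fin n → Fin m) → Injective _≡_ _≡_ ρ →
    f · _⊕_ Th (base Th ρ) (𝟏 p) ≡ base Th ρ · g →
    (f †) ≡ base Th ρ · (g †)

  ZeroIdentity : Set ℓ
  ZeroIdentity =
    ∀ {n m p} (f : Hom n (n + p)) (g : Hom m (n + m + p)) →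
    𝟏⊕0 Th n m
      · (⟨_,_⟩ Th (f · _⊕_ Th (𝟏⊕0 Th n m) (𝟏 p)) g †)
      ≡ (f †)

-- An injective base morphism ρ : n → n + k factors as ι · π, where ι is the
-- injection onto the first n positions and π is a base permutation extending ρ.
-- Conjugating g by π (which the permutation identity controls) turns the
-- hypothesis f · (ρ ⊕ 𝟏) = ρ · g into f · (ι ⊕ 𝟏) = ι · g′; so g′ has the block
-- form ⟨ f · (ι ⊕ 𝟏) , _ ⟩ and the zero identity gives f† = ι · g′† = ρ · g†.
-- Conversely, both identities are instances of the functorial implication, with
-- ρ a permutation and ρ = ι respectively.
module Submission where

open import Defs
open import Level using (Level)
open import Data.Product using (_×_; _,_; Σ-syntax; proj₁; proj₂)
open import Function.Bundles using (_⇔_; mk⇔; Injection)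
open import Function.Properties.Inverse using (↔⇒↣)
open import Function.Definitions using (Injective)
open import Function using (_∘_; id)
open import Data.Nat using (zero; suc; _+_)
open import Data.Nat.Properties using (+-identityʳ; m≤n⇒∃[o]m+o≡n)
open import Data.Fin using (Fin; _↑ˡ_; _↑ʳ_; splitAt; join; toℕ; punchIn; punchOut)
  renaming (zero to 0F; suc to 1+)
open import Data.Fin.Properties
  using (splitAt-↑ˡ; splitAt-↑ʳ; join-splitAt; toℕ-↑ˡ; toℕ-injective; ↑ˡ-injective;
         0≢1+n; suc-injective; punchIn-punchOut; punchOut-injective; injective⇒≤)
open import Data.Fin.Permutation
  using (Permutation′; _⟨$⟩ʳ_; _⟨$⟩ˡ_; inverseˡ; inverseʳ; insert; insert-punchIn)
  renaming (id to idₚ)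
open import Data.Sum using (inj₁; inj₂)
open import Relation.Binary.PropositionalEquality

injection-extends-to-permutation :
  ∀ {n k} (ρ : Fin n → Fin (n + k)) → Injective _≡_ _≡_ ρ →
  Σ[ π ∈ Permutation′ (n + k) ] (∀ j → π ⟨$⟩ʳ (j ↑ˡ k) ≡ ρ j)
injection-extends-to-permutation {zero} ρ _ = idₚ , λ ()
injection-extends-to-permutation {suc n} {k} ρ ρ-inj = insert 0F (ρ 0F) π , extends
  where
  ρ0≢ρ1+ : ∀ j → ρ 0F ≢ ρ (1+ j)
  ρ0≢ρ1+ j = 0≢1+n ∘ ρ-inj

  ρ′ : Fin n → Fin (n + k)
  ρ′ j = punchOut (ρ0≢ρ1+ j)

  ρ′-inj : Injective _≡_ _≡_ ρ′
  ρ′-inj {a} {b} eq = suc-injective (ρ-inj (punchOut-injective (ρ0≢ρ1+ a) (ρ0≢ρ1+ b) eq))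

  π-extends-ρ′ : Σ[ π ∈ Permutation′ (n + k) ] (∀ j → π ⟨$⟩ʳ (j ↑ˡ k) ≡ ρ′ j)
  π-extends-ρ′ = injection-extends-to-permutation ρ′ ρ′-inj

  π : Permutation′ (n + k)
  π = proj₁ π-extends-ρ′

  extends : ∀ j → insert 0F (ρ 0F) π ⟨$⟩ʳ (j ↑ˡ k) ≡ ρ j
  extends 0F = refl
  extends (1+ j) = begin
    insert 0F (ρ 0F) π ⟨$⟩ʳ punchIn 0F (j ↑ˡ k) ≡⟨ insert-punchIn 0F (ρ 0F) π (j ↑ˡ k) ⟩
    punchIn (ρ 0F) (π ⟨$⟩ʳ (j ↑ˡ k))            ≡⟨ cong (punchIn (ρ 0F)) (proj₂ (injection-extends-to-permutation ρ′ ρ′-inj) j) ⟩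
    punchIn (ρ 0F) (ρ′ j)                        ≡⟨ punchIn-punchOut (ρ0≢ρ1+ j) ⟩
    ρ (1+ j)                                     ∎
    where open ≡-Reasoning

module TheoryProperties {ℓ} (T : Theory ℓ) where
  open Theory T

  ⌜_⌝ : ∀ {n p} → (Fin n → Fin p) → Hom n p
  ⌜_⌝ = base T

  ⟪_,_⟫ : ∀ {n m p} → Hom n p → Hom m p → Hom (n + m) p
  ⟪_,_⟫ = ⟨_,_⟩ T

  infixl 6 _⊞_
  _⊞_ : ∀ {n p m q} → Hom n p → Hom m q → Hom (n + m) (p + q)
  _⊞_ = _⊕_ T

  components-ext : ∀ {n p} {h h′ : Hom n p} → (∀ j → i n j · h ≡ i n j · h′) → h ≡ h′
  components-ext {h = h} {h′} eq =
    trans (tuple-unique _ h eq) (sym (tuple-unique _ h′ (λ _ → refl)))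

  split-ext : ∀ {n m p} {h h′ : Hom (n + m) p} →
              (∀ a → i (n + m) (a ↑ˡ m) · h ≡ i (n + m) (a ↑ˡ m) · h′) →
              (∀ b → i (n + m) (n ↑ʳ b) · h ≡ i (n + m) (n ↑ʳ b) · h′) → h ≡ h′
  split-ext {n} {m} {h = h} {h′} eqˡ eqʳ =
    components-ext λ j → subst (λ x → i (n + m) x · h ≡ i (n + m) x · h′)
                               (join-splitAt n m j) (on-join (splitAt n j))
    where
    on-join : ∀ s → i (n + m) (join n m s) · h ≡ i (n + m) (join n m s) · h′
    on-join (inj₁ a) = eqˡ a
    on-join (inj₂ b) = eqʳ b

  i·⌜⌝ : ∀ {n p} (ρ : Fin n → Fin p) j → i n j · ⌜ ρ ⌝ ≡ i p (ρ j)
  i·⌜⌝ ρ = tuple-comp _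

  i·⌜⌝· : ∀ {n m p} (ρ : Fin n → Fin m) (h : Hom m p) j → i n j · (⌜ ρ ⌝ · h) ≡ i m (ρ j) · h
  i·⌜⌝· ρ h j = trans (sym (·-assoc _ _ _)) (cong (_· h) (i·⌜⌝ ρ j))

  i·tuple : ∀ {n p} {fs : Fin n → Hom 1 p} {h : Hom n p} → h ≡ tuple fs → ∀ j → i n j · h ≡ fs j
  i·tuple refl = tuple-comp _

  -- Going through i·tuple fixes the component family before the with-abstraction,
  -- so that splitAt (a ↑ˡ m) occurs in the abstracted type.
  i↑ˡ·⟪,⟫ : ∀ {n m p} (f : Hom n p) (g : Hom m p) a → i (n + m) (a ↑ˡ m) · ⟪ f , g ⟫ ≡ i n a · f
  i↑ˡ·⟪,⟫ {n} {m} f g a with splitAt n (a ↑ˡ m) | splitAt-↑ˡ n a m | i·tuple {h = ⟪ f , g ⟫} refl (a ↑ˡ m)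
  ... | _ | refl | eq = eq

  i↑ʳ·⟪,⟫ : ∀ {n m p} (f : Hom n p) (g : Hom m p) b → i (n + m) (n ↑ʳ b) · ⟪ f , g ⟫ ≡ i m b · g
  i↑ʳ·⟪,⟫ {n} {m} f g b with splitAt n (n ↑ʳ b) | splitAt-↑ʳ n m b | i·tuple {h = ⟪ f , g ⟫} refl (n ↑ʳ b)
  ... | _ | refl | eq = eq

  ⌜↑ˡ⌝·⟪,⟫ : ∀ {n m p} (f : Hom n p) (g : Hom m p) → ⌜ _↑ˡ m ⌝ · ⟪ f , g ⟫ ≡ f
  ⌜↑ˡ⌝·⟪,⟫ f g = components-ext λ a → trans (i·⌜⌝· _ _ a) (i↑ˡ·⟪,⟫ f g a)

  ⟪,⟫-η : ∀ {n m p} (h : Hom (n + m) p) → ⟪ ⌜ _↑ˡ m ⌝ · h , ⌜ n ↑ʳ_ ⌝ · h ⟫ ≡ h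
  ⟪,⟫-η {n} {m} h = split-ext {n} {m}
    (λ a → trans (i↑ˡ·⟪,⟫ _ (⌜ n ↑ʳ_ ⌝ · h) a) (i·⌜⌝· _ h a))
    (λ b → trans (i↑ʳ·⟪,⟫ (⌜ _↑ˡ m ⌝ · h) _ b) (i·⌜⌝· _ h b))

  ⌜⌝-cong : ∀ {n m} {α β : Fin n → Fin m} → (∀ x → α x ≡ β x) → ⌜ α ⌝ ≡ ⌜ β ⌝
  ⌜⌝-cong α≗β = components-ext λ j → trans (i·⌜⌝ _ j) (trans (cong (i _) (α≗β j)) (sym (i·⌜⌝ _ j)))

  ⌜⌝-· : ∀ {n m r} (α : Fin n → Fin m) (β : Fin m → Fin r) → ⌜ α ⌝ · ⌜ β ⌝ ≡ ⌜ β ∘ α ⌝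
  ⌜⌝-· α β = components-ext λ j → trans (i·⌜⌝· α _ j) (trans (i·⌜⌝ β (α j)) (sym (i·⌜⌝ _ j)))

  i↑ˡ·⌜⌝⊞𝟏 : ∀ {n m} p (ρ : Fin n → Fin m) a → i (n + p) (a ↑ˡ p) · (⌜ ρ ⌝ ⊞ 𝟏 p) ≡ i (m + p) (ρ a ↑ˡ p)
  i↑ˡ·⌜⌝⊞𝟏 p ρ a = trans (i↑ˡ·⟪,⟫ _ _ a) (trans (i·⌜⌝· ρ _ a) (i·⌜⌝ _ (ρ a)))

  i↑ʳ·⌜⌝⊞𝟏 : ∀ {n m} p (ρ : Fin n → Fin m) b → i (n + p) (n ↑ʳ b) · (⌜ ρ ⌝ ⊞ 𝟏 p) ≡ i (m + p) (m ↑ʳ b)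
  i↑ʳ·⌜⌝⊞𝟏 p ρ b = trans (i↑ʳ·⟪,⟫ _ _ b) (trans (cong (i p b ·_) (·-idˡ _)) (i·⌜⌝ _ b))

  ⌜⌝⊞𝟏-· : ∀ {n m r} p (α : Fin n → Fin m) (β : Fin m → Fin r) →
           (⌜ α ⌝ ⊞ 𝟏 p) · (⌜ β ⌝ ⊞ 𝟏 p) ≡ ⌜ β ∘ α ⌝ ⊞ 𝟏 p
  ⌜⌝⊞𝟏-· p α β = split-ext
    (λ a → begin
      i _ (a ↑ˡ p) · ((⌜ α ⌝ ⊞ 𝟏 p) · (⌜ β ⌝ ⊞ 𝟏 p)) ≡⟨ sym (·-assoc _ _ _) ⟩
      i _ (a ↑ˡ p) · (⌜ α ⌝ ⊞ 𝟏 p) · (⌜ β ⌝ ⊞ 𝟏 p)   ≡⟨ cong (_· (⌜ β ⌝ ⊞ 𝟏 p)) (i↑ˡ·⌜⌝⊞𝟏 p α a) ⟩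
      i _ (α a ↑ˡ p) · (⌜ β ⌝ ⊞ 𝟏 p)                 ≡⟨ i↑ˡ·⌜⌝⊞𝟏 p β (α a) ⟩
      i _ (β (α a) ↑ˡ p)                             ≡⟨ sym (i↑ˡ·⌜⌝⊞𝟏 p (β ∘ α) a) ⟩
      i _ (a ↑ˡ p) · (⌜ β ∘ α ⌝ ⊞ 𝟏 p)               ∎)
    (λ b → begin
      i _ (_ ↑ʳ b) · ((⌜ α ⌝ ⊞ 𝟏 p) · (⌜ β ⌝ ⊞ 𝟏 p)) ≡⟨ sym (·-assoc _ _ _) ⟩
      i _ (_ ↑ʳ b) · (⌜ α ⌝ ⊞ 𝟏 p) · (⌜ β ⌝ ⊞ 𝟏 p)   ≡⟨ cong (_· (⌜ β ⌝ ⊞ 𝟏 p)) (i↑ʳ·⌜⌝⊞𝟏 p α b) ⟩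
      i _ (_ ↑ʳ b) · (⌜ β ⌝ ⊞ 𝟏 p)                   ≡⟨ i↑ʳ·⌜⌝⊞𝟏 p β b ⟩
      i _ (_ ↑ʳ b)                                   ≡⟨ sym (i↑ʳ·⌜⌝⊞𝟏 p (β ∘ α) b) ⟩
      i _ (_ ↑ʳ b) · (⌜ β ∘ α ⌝ ⊞ 𝟏 p)               ∎)
    where open ≡-Reasoning

  ⌜id⌝⊞𝟏 : ∀ {n} p → ⌜ id {A = Fin n} ⌝ ⊞ 𝟏 p ≡ 𝟏 (n + p)
  ⌜id⌝⊞𝟏 p = split-ext (λ a → trans (i↑ˡ·⌜⌝⊞𝟏 p id a) (sym (·-idʳ _)))
                       (λ b → trans (i↑ʳ·⌜⌝⊞𝟏 p id b) (sym (·-idʳ _)))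

  ⌜⌝⊞𝟏-cancel : ∀ {n m} p (α : Fin n → Fin m) (β : Fin m → Fin n) → (∀ x → β (α x) ≡ x) →
                (⌜ α ⌝ ⊞ 𝟏 p) · (⌜ β ⌝ ⊞ 𝟏 p) ≡ 𝟏 (n + p)
  ⌜⌝⊞𝟏-cancel p α β β∘α≗id = begin
    (⌜ α ⌝ ⊞ 𝟏 p) · (⌜ β ⌝ ⊞ 𝟏 p) ≡⟨ ⌜⌝⊞𝟏-· p α β ⟩
    ⌜ β ∘ α ⌝ ⊞ 𝟏 p               ≡⟨ cong (_⊞ 𝟏 p) (⌜⌝-cong β∘α≗id) ⟩
    ⌜ id ⌝ ⊞ 𝟏 p                  ≡⟨ ⌜id⌝⊞𝟏 p ⟩
    𝟏 _                           ∎
    where open ≡-Reasoning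

  -- 𝟏⊕0 is stated on n + 0 and transported to n; compare indices through toℕ.
  𝟏⊕0≡⌜↑ˡ⌝ : ∀ n m → 𝟏⊕0 T n m ≡ ⌜ _↑ˡ m ⌝
  𝟏⊕0≡⌜↑ˡ⌝ n m = components-ext λ j → begin
    i n j · 𝟏⊕0 T n m                              ≡⟨ i·subst (+-identityʳ n) (𝟏 n ⊞ 0ₕ T m) j ⟩
    i (n + 0) (subst Fin (sym (+-identityʳ n)) j) · (𝟏 n ⊞ 0ₕ T m)
                                                   ≡⟨ cong (λ x → i (n + 0) x · (𝟏 n ⊞ 0ₕ T m)) (subst-≡-↑ˡ j) ⟩
    i (n + 0) (j ↑ˡ 0) · (𝟏 n ⊞ 0ₕ T m)            ≡⟨ i↑ˡ·𝟏⊞0 j ⟩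
    i n j · ⌜ _↑ˡ m ⌝                     ∎
    where
    open ≡-Reasoning
    i·subst : ∀ {a b q} (e : a ≡ b) (h : Hom a q) j →
              i b j · subst (λ k → Hom k q) e h ≡ i a (subst Fin (sym e) j) · h
    i·subst refl h j = refl
    toℕ-subst : ∀ {a b} (e : a ≡ b) (j : Fin b) → toℕ (subst Fin (sym e) j) ≡ toℕ j
    toℕ-subst refl j = refl
    subst-≡-↑ˡ : ∀ j → subst Fin (sym (+-identityʳ n)) j ≡ j ↑ˡ 0
    subst-≡-↑ˡ j = toℕ-injective (trans (toℕ-subst (+-identityʳ n) j) (sym (toℕ-↑ˡ j 0)))
    i↑ˡ·𝟏⊞0 : ∀ j → i (n + 0) (j ↑ˡ 0) · (𝟏 n ⊞ 0ₕ T m) ≡ i n j · ⌜ _↑ˡ m ⌝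
    i↑ˡ·𝟏⊞0 j = trans (i↑ˡ·⟪,⟫ _ _ j) (cong (i n j ·_) (·-idˡ _))

module _ {ℓ} (T : PreiterationTheory ℓ) where
  open PreiterationTheory T
  open TheoryProperties theory

  conjugate : ∀ {n p} → Permutation′ n → Hom n (n + p) → Hom n (n + p)
  conjugate {p = p} π f = ⌜ π ⟨$⟩ʳ_ ⌝ · f · (⌜ π ⟨$⟩ˡ_ ⌝ ⊞ 𝟏 p)

  conjugate-intertwines : ∀ {n p} (π : Permutation′ n) (f : Hom n (n + p)) →
                          conjugate π f · (⌜ π ⟨$⟩ʳ_ ⌝ ⊞ 𝟏 p) ≡ ⌜ π ⟨$⟩ʳ_ ⌝ · f
  conjugate-intertwines {p = p} π f = begin
    ⌜ π ⟨$⟩ʳ_ ⌝ · f · (⌜ π ⟨$⟩ˡ_ ⌝ ⊞ 𝟏 p) · (⌜ π ⟨$⟩ʳ_ ⌝ ⊞ 𝟏 p)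
      ≡⟨ ·-assoc _ _ _ ⟩
    ⌜ π ⟨$⟩ʳ_ ⌝ · f · ((⌜ π ⟨$⟩ˡ_ ⌝ ⊞ 𝟏 p) · (⌜ π ⟨$⟩ʳ_ ⌝ ⊞ 𝟏 p))
      ≡⟨ cong (⌜ π ⟨$⟩ʳ_ ⌝ · f ·_) (⌜⌝⊞𝟏-cancel p _ _ (λ _ → inverseʳ π)) ⟩
    ⌜ π ⟨$⟩ʳ_ ⌝ · f · 𝟏 _
      ≡⟨ ·-idʳ _ ⟩
    ⌜ π ⟨$⟩ʳ_ ⌝ · f ∎
    where open ≡-Reasoning

  functorial⇒permutation : FunctorialImplicationInj T → PermutationIdentity T
  functorial⇒permutation functorial f π =
    functorial (conjugate π f) f _ (Injection.injective (↔⇒↣ π)) (conjugate-intertwines π f)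

  functorial⇒zero : FunctorialImplicationInj T → ZeroIdentity T
  functorial⇒zero functorial {n} {m} {p} f g
    rewrite 𝟏⊕0≡⌜↑ˡ⌝ n m =
    sym (functorial f ⟪ f′ , g ⟫ (_↑ˡ m) (↑ˡ-injective m _ _) (sym (⌜↑ˡ⌝·⟪,⟫ f′ g)))
    where
    f′ : Hom n (n + m + p)
    f′ = f · (⌜ _↑ˡ m ⌝ ⊞ 𝟏 p)

  zero-identity-↑ˡ : ZeroIdentity T → ∀ {n m p} (f : Hom n (n + p)) (g : Hom m (n + m + p)) →
                     ⌜ _↑ˡ m ⌝ · (⟪ f · (⌜ _↑ˡ m ⌝ ⊞ 𝟏 p) , g ⟫ †) ≡ (f †)
  zero-identity-↑ˡ zero-identity {n} {m} f g rewrite sym (𝟏⊕0≡⌜↑ˡ⌝ n m) = zero-identity f g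

  permutation∧zero⇒functorial-↑ˡ :
    PermutationIdentity T → ZeroIdentity T →
    ∀ {n k p} (f : Hom n (n + p)) (g : Hom (n + k) (n + k + p))
    (ρ : Fin n → Fin (n + k)) → Injective _≡_ _≡_ ρ →
    f · (⌜ ρ ⌝ ⊞ 𝟏 p) ≡ ⌜ ρ ⌝ · g → (f †) ≡ ⌜ ρ ⌝ · (g †)
  permutation∧zero⇒functorial-↑ˡ permutation zero-identity {n} {k} {p} f g ρ ρ-inj f·ρ≡ρ·g
    with injection-extends-to-permutation ρ ρ-inj
  ... | π , π-extends = begin
    (f †)                                        ≡⟨ sym (zero-identity-↑ˡ zero-identity f _) ⟩
    ι · (⟪ f · (ι ⊞ 𝟏 p) , ⌜ n ↑ʳ_ ⌝ · g′ ⟫ †)    ≡⟨ cong (λ h → ι · (h †)) g′-split ⟩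
    ι · (g′ †)                                   ≡⟨ cong (ι ·_) (permutation g π) ⟩
    ι · (P · (g †))                              ≡⟨ sym (·-assoc _ _ _) ⟩
    ι · P · (g †)                                ≡⟨ cong (_· (g †)) ι·P≡ρ ⟩
    ⌜ ρ ⌝ · (g †)                                ∎
    where
    open ≡-Reasoning
    ι : Hom n (n + k)
    ι = ⌜ _↑ˡ k ⌝
    P P⁻¹ : Hom (n + k) (n + k)
    P = ⌜ π ⟨$⟩ʳ_ ⌝
    P⁻¹ = ⌜ π ⟨$⟩ˡ_ ⌝
    g′ : Hom (n + k) (n + k + p)
    g′ = conjugate π g

    ι·P≡ρ : ι · P ≡ ⌜ ρ ⌝
    ι·P≡ρ = trans (⌜⌝-· _ _) (⌜⌝-cong π-extends)

    π⁻¹∘ρ≗↑ˡ : ∀ a → π ⟨$⟩ˡ ρ a ≡ a ↑ˡ k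
    π⁻¹∘ρ≗↑ˡ a = trans (cong (π ⟨$⟩ˡ_) (sym (π-extends a))) (inverseˡ π)

    ι·g′ : ι · g′ ≡ f · (ι ⊞ 𝟏 p)
    ι·g′ = begin
      ι · (P · g · (P⁻¹ ⊞ 𝟏 p))       ≡⟨ sym (·-assoc _ _ _) ⟩
      ι · (P · g) · (P⁻¹ ⊞ 𝟏 p)       ≡⟨ cong (_· (P⁻¹ ⊞ 𝟏 p)) (sym (·-assoc _ _ _)) ⟩
      ι · P · g · (P⁻¹ ⊞ 𝟏 p)         ≡⟨ cong (λ h → h · g · (P⁻¹ ⊞ 𝟏 p)) ι·P≡ρ ⟩
      ⌜ ρ ⌝ · g · (P⁻¹ ⊞ 𝟏 p)         ≡⟨ cong (_· (P⁻¹ ⊞ 𝟏 p)) (sym f·ρ≡ρ·g) ⟩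
      f · (⌜ ρ ⌝ ⊞ 𝟏 p) · (P⁻¹ ⊞ 𝟏 p) ≡⟨ ·-assoc _ _ _ ⟩
      f · ((⌜ ρ ⌝ ⊞ 𝟏 p) · (P⁻¹ ⊞ 𝟏 p)) ≡⟨ cong (f ·_) (⌜⌝⊞𝟏-· p _ _) ⟩
      f · (⌜ (π ⟨$⟩ˡ_) ∘ ρ ⌝ ⊞ 𝟏 p)   ≡⟨ cong (λ h → f · (h ⊞ 𝟏 p)) (⌜⌝-cong π⁻¹∘ρ≗↑ˡ) ⟩
      f · (ι ⊞ 𝟏 p)                   ∎

    g′-split : ⟪ f · (ι ⊞ 𝟏 p) , ⌜ n ↑ʳ_ ⌝ · g′ ⟫ ≡ g′
    g′-split = trans (cong ⟪_, ⌜ n ↑ʳ_ ⌝ · g′ ⟫ (sym ι·g′)) (⟪,⟫-η {n} {k} g′)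

  permutation∧zero⇒functorial : PermutationIdentity T → ZeroIdentity T → FunctorialImplicationInj T
  permutation∧zero⇒functorial permutation zero-identity f g ρ ρ-inj
    with m≤n⇒∃[o]m+o≡n (injective⇒≤ ρ-inj)
  ... | _ , refl = permutation∧zero⇒functorial-↑ˡ permutation zero-identity f g ρ ρ-inj

lemma1 : ∀ {ℓ : Level} (T : PreiterationTheory ℓ) →
    FunctorialImplicationInj T ⇔ (PermutationIdentity T × ZeroIdentity T)
lemma1 T = mk⇔ {A = FunctorialImplicationInj T} {B = PermutationIdentity T × ZeroIdentity T}
  (λ functorial → functorial⇒permutation T functorial , functorial⇒zero T functorial)
  (λ (permutation , zero-identity) → permutation∧zero⇒functorial T permutation zero-identity)
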